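{- For each integer $r \ge 2$, the matrix $A'_r$ is $2$-modular.
   Context: An integer matrix $A$ is $2$-modular if the determinant of every $\operatorname{rank}(A) \times \operatorname{rank}(A)$ submatrix has absolute value at most $2$. $D_r$ denotes the $r \times \binom{r}{2}$ matrix whose columns are all $r$-tuples with exactly two nonzero entries, the first (in position order) equal to $1$ and the second equal to $-1$. $A'_r$ is the $r$-row matrix $[\,I_r \mid D_r \mid B' \mid c\,]$, where $B'$ is the $r \times (r-2)$ matrix whose first two rows are all ones and whose remaining $r-2$ rows form $-I_{r-2}$ (so $B'$ is empty when $r=2$), and $c$ is the column $(1,1,0,\dots,0)^T$. -}

module Defs where

open import Data.Nat as ℕ using (ℕ; zero; suc; _∸_)
open import Data.Integer as ℤ using (ℤ; +_; -_; _+_; _*_; ∣_∣; 0ℤ; 1ℤ)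
open import Data.Fin as Fin using (Fin; toℕ; punchIn)
open import Data.List as List using (List; []; _∷_; _++_; concatMap; map; upTo; allFin; length; lookup; filterᵇ)
open import Data.Bool using (Bool; true; false; if_then_else_; _∧_)
open import Data.Product using (Σ; _×_; ∃)
open import Relation.Binary.PropositionalEquality using (_≡_; _≢_)

Matrix : ℕ → ℕ → Set
Matrix m n = Fin m → Fin n → ℤ

sumFin : ∀ n → (Fin n → ℤ) → ℤ
sumFin zero    f = 0ℤ
sumFin (suc n) f = f Fin.zero + sumFin n (λ i → f (Fin.suc i))

sign : ℕ → ℤ
sign zero    = 1ℤ
sign (suc k) = - sign k

det : ∀ n → Matrix n n → ℤ
det zero    M = 1ℤ
det (suc n) M =
  sumFin (suc n) (λ j → sign (toℕ j) * (M Fin.zero j * det n (λ a b → M (Fin.suc a) (punchIn j b))))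

Increasing : ∀ {k m} → (Fin k → Fin m) → Set
Increasing {k} f = ∀ (i j : Fin k) → i Fin.< j → f i Fin.< f j

submatrix : ∀ {m n k} → Matrix m n → (Fin k → Fin m) → (Fin k → Fin n) → Matrix k k
submatrix A f g i j = A (f i) (g j)

HasRank : ∀ {m n} → Matrix m n → ℕ → Set
HasRank {m} {n} A k =
  (Σ (Fin k → Fin m) λ f → Σ (Fin k → Fin n) λ g →
     Increasing f × Increasing g × det k (submatrix A f g) ≢ 0ℤ)
  × (∀ l → k ℕ.< l → (f : Fin l → Fin m) (g : Fin l → Fin n) →
       Increasing f → Increasing g → det l (submatrix A f g) ≡ 0ℤ)

IsModular : ∀ {m n} → ℕ → Matrix m n → Set
IsModular {m} {n} Δ A =
  ∀ k → HasRank A k → (f : Fin k → Fin m) (g : Fin k → Fin n) →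
    Increasing f → Increasing g → ∣ det k (submatrix A f g) ∣ ℕ.≤ Δ

Col : ℕ → Set
Col r = Fin r → ℤ

fromCols : ∀ {r} (cs : List (Col r)) → Matrix r (length cs)
fromCols cs i j = lookup cs j i

δ : ∀ {r} → Fin r → Fin r → ℤ
δ i k = if toℕ k ℕ.≡ᵇ toℕ i then 1ℤ else 0ℤ

identityCols : ∀ r → List (Col r)
identityCols r = map (λ i → δ i) (allFin r)

Dcols : ∀ r → List (Col r)
Dcols r = concatMap (λ i → concatMap (λ j →
            if toℕ i ℕ.<ᵇ toℕ j then (λ k → δ i k + - δ j k) ∷ [] else [])
            (allFin r)) (allFin r)

Bcols : ∀ r → List (Col r)
Bcols r = map (λ t k → if toℕ k ℕ.<ᵇ 2 then 1ℤ
                        else (if toℕ k ℕ.≡ᵇ (2 ℕ.+ t) then - 1ℤ else 0ℤ))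
              (upTo (r ∸ 2))

cCol : ∀ r → Col r
cCol r k = if toℕ k ℕ.<ᵇ 2 then 1ℤ else 0ℤ

A'cols : ∀ r → List (Col r)
A'cols r = identityCols r ++ Dcols r ++ Bcols r ++ (cCol r ∷ [])

A' : ∀ r → Matrix r (length (A'cols r))
A' r = fromCols (A'cols r)

{-# OPTIONS --safe #-}
module Submission where

-- Every column of A'_r is a network column e_p − e_q (either term possibly absent) or a
-- two-headed column e₀ + e₁ − e_q.  A square matrix of network columns has determinant 0 or
-- ±1: pivoting on a ±1 entry of the first row, column operations clear that row and leave a
-- network minor.  If a square submatrix has a two-headed column, subtracting it from the
-- other two-headed columns turns them into network columns, and splitting it as
-- (e₀ − e_q) + e₁ writes the determinant as a sum of two network determinants.  Since I_r
-- sits inside A'_r, its rank is r, so the minors in question use all rows.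

open import Defs
open import Data.Nat using (ℕ; _≤_)
open import Data.Nat as ℕ using (zero; suc; z≤n; s≤s)
import Data.Nat.Properties as ℕP
open import Data.Integer as ℤ using (ℤ; -_; _+_; _*_; ∣_∣; 0ℤ; 1ℤ)
import Data.Integer.Properties as ℤP
open import Data.Integer.Tactic.RingSolver using (solve-∀)
open import Data.Fin as Fin using (Fin; toℕ; punchIn; punchOut)
import Data.Fin.Properties as FinP
open import Data.Bool using (true; false; if_then_else_)
open import Data.Maybe using (Maybe; just; nothing)
open import Data.Product using (Σ; _×_; _,_; proj₁; proj₂; ∃)
open import Data.Sum using (_⊎_; inj₁; inj₂)
open import Data.Empty using (⊥-elim)
open import Function using (_∘_)
open import Relation.Nullary using (Dec; yes; no; does)
open import Relation.Nullary.Decidable using (dec-true; dec-false; toSum)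
open import Relation.Binary.PropositionalEquality
open import Data.List using ([]; _∷_; _++_; map; tabulate; length; lookup)
open import Data.List.Relation.Unary.All as All using (All; []; _∷_)
open import Data.List.Relation.Unary.All.Properties using (++⁺; map⁺; concat⁺; tabulate⁺; applyUpTo⁺₂)
open import Data.List.Membership.Propositional.Properties using (∈-lookup)
open import Relation.Binary.Definitions using (tri<; tri≈; tri>)

open ≡-Reasoning

sumFin-cong : ∀ n {f g : Fin n → ℤ} → (∀ j → f j ≡ g j) → sumFin n f ≡ sumFin n g
sumFin-cong zero    f≡g = refl
sumFin-cong (suc n) f≡g = cong₂ _+_ (f≡g Fin.zero) (sumFin-cong n (f≡g ∘ Fin.suc))

sumFin-zero : ∀ n {f : Fin n → ℤ} → (∀ j → f j ≡ 0ℤ) → sumFin n f ≡ 0ℤ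
sumFin-zero zero    f≡0 = refl
sumFin-zero (suc n) f≡0 = cong₂ _+_ (f≡0 Fin.zero) (sumFin-zero n (f≡0 ∘ Fin.suc))

sumFin-linear : ∀ n (f g : Fin n → ℤ) a →
  sumFin n (λ j → f j + a * g j) ≡ sumFin n f + a * sumFin n g
sumFin-linear zero    f g a = sym (trans (ℤP.+-identityˡ _) (ℤP.*-zeroʳ a))
sumFin-linear (suc n) f g a =
  trans (cong (f Fin.zero + a * g Fin.zero +_) (sumFin-linear n (f ∘ Fin.suc) (g ∘ Fin.suc) a))
        (regroup a (f Fin.zero) _ (g Fin.zero) _)
  where
  regroup : ∀ a x y u v → (x + a * u) + (y + a * v) ≡ (x + y) + a * (u + v)
  regroup = solve-∀

sumFin-punchIn : ∀ n (f : Fin (suc n) → ℤ) j → sumFin (suc n) f ≡ f j + sumFin n (f ∘ punchIn j)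
sumFin-punchIn n       f Fin.zero    = refl
sumFin-punchIn (suc n) f (Fin.suc j) =
  trans (cong (f Fin.zero +_) (sumFin-punchIn n (f ∘ Fin.suc) j)) (swap (f Fin.zero) (f (Fin.suc j)) _)
  where
  swap : ∀ x y z → x + (y + z) ≡ y + (x + z)
  swap = solve-∀

sumFin-single : ∀ n (f : Fin n → ℤ) j → (∀ k → k ≢ j → f k ≡ 0ℤ) → sumFin n f ≡ f j
sumFin-single (suc n) f j f≡0 = begin
  sumFin (suc n) f                   ≡⟨ sumFin-punchIn n f j ⟩
  f j + sumFin n (f ∘ punchIn j)     ≡⟨ cong (f j +_) (sumFin-zero n (λ b → f≡0 _ (FinP.punchInᵢ≢i j b))) ⟩
  f j + 0ℤ                           ≡⟨ ℤP.+-identityʳ (f j) ⟩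
  f j                                ∎

sumFin-pair : ∀ n (f : Fin n → ℤ) x y → x ≢ y → (∀ k → k ≢ x → k ≢ y → f k ≡ 0ℤ) →
  sumFin n f ≡ f x + f y
sumFin-pair (suc n) f x y x≢y f≡0 = begin
  sumFin (suc n) f                   ≡⟨ sumFin-punchIn n f x ⟩
  f x + sumFin n (f ∘ punchIn x)     ≡⟨ cong (f x +_) (sumFin-single n _ y′ f∘punchIn≡0) ⟩
  f x + f (punchIn x y′)             ≡⟨ cong (λ k → f x + f k) (FinP.punchIn-punchOut x≢y) ⟩
  f x + f y                          ∎
  where
  y′ = punchOut x≢y
  f∘punchIn≡0 : ∀ b → b ≢ y′ → f (punchIn x b) ≡ 0ℤ
  f∘punchIn≡0 b b≢y′ = f≡0 _ (FinP.punchInᵢ≢i x b) λ e →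
    b≢y′ (FinP.punchIn-injective x b y′ (trans e (sym (FinP.punchIn-punchOut x≢y))))

all⊎any : ∀ n {P Q : Fin n → Set} → (∀ j → P j ⊎ Q j) → (∀ j → P j) ⊎ ∃ Q
all⊎any zero    P⊎Q = inj₁ λ ()
all⊎any (suc n) P⊎Q with P⊎Q Fin.zero | all⊎any n (P⊎Q ∘ Fin.suc)
... | inj₂ q | _             = inj₂ (Fin.zero , q)
... | inj₁ _ | inj₂ (j , q)  = inj₂ (Fin.suc j , q)
... | inj₁ p | inj₁ ps       = inj₁ λ { Fin.zero → p ; (Fin.suc j) → ps j }

-- Determinants: Laplace expansion, multilinearity, adjacent equal columns

minor : ∀ {n} → Matrix (suc n) (suc n) → Fin (suc n) → Matrix n n
minor M j a b = M (Fin.suc a) (punchIn j b)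

laplaceTerm : ∀ {n} → Matrix (suc n) (suc n) → Fin (suc n) → ℤ
laplaceTerm {n} M j = sign (toℕ j) * (M Fin.zero j * det n (minor M j))

laplaceTerm-entry≡0 : ∀ {n} (M : Matrix (suc n) (suc n)) j → M Fin.zero j ≡ 0ℤ → laplaceTerm M j ≡ 0ℤ
laplaceTerm-entry≡0 {n} M j M0j≡0 = begin
  sign (toℕ j) * (M Fin.zero j * det n (minor M j)) ≡⟨ cong (λ m → sign (toℕ j) * (m * det n (minor M j))) M0j≡0 ⟩
  sign (toℕ j) * (0ℤ * det n (minor M j))           ≡⟨ cong (sign (toℕ j) *_) (ℤP.*-zeroˡ (det n (minor M j))) ⟩
  sign (toℕ j) * 0ℤ                                 ≡⟨ ℤP.*-zeroʳ (sign (toℕ j)) ⟩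
  0ℤ                                                ∎

laplaceTerm-minor≡0 : ∀ {n} (M : Matrix (suc n) (suc n)) j → det n (minor M j) ≡ 0ℤ → laplaceTerm M j ≡ 0ℤ
laplaceTerm-minor≡0 {n} M j minor≡0 = begin
  sign (toℕ j) * (M Fin.zero j * det n (minor M j)) ≡⟨ cong (λ d → sign (toℕ j) * (M Fin.zero j * d)) minor≡0 ⟩
  sign (toℕ j) * (M Fin.zero j * 0ℤ)                ≡⟨ cong (sign (toℕ j) *_) (ℤP.*-zeroʳ (M Fin.zero j)) ⟩
  sign (toℕ j) * 0ℤ                                 ≡⟨ ℤP.*-zeroʳ (sign (toℕ j)) ⟩
  0ℤ                                                ∎

det-cong : ∀ n {M N : Matrix n n} → (∀ i j → M i j ≡ N i j) → det n M ≡ det n N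
det-cong zero    M≡N = refl
det-cong (suc n) M≡N = sumFin-cong (suc n) λ j →
  cong₂ (λ m d → sign (toℕ j) * (m * d)) (M≡N Fin.zero j) (det-cong n λ a b → M≡N (Fin.suc a) (punchIn j b))

det-firstRowZero : ∀ n (M : Matrix (suc n) (suc n)) → (∀ j → M Fin.zero j ≡ 0ℤ) → det (suc n) M ≡ 0ℤ
det-firstRowZero n M row≡0 = sumFin-zero (suc n) λ j → laplaceTerm-entry≡0 M j (row≡0 j)

det-firstRowSingle : ∀ n (M : Matrix (suc n) (suc n)) j → (∀ k → k ≢ j → M Fin.zero k ≡ 0ℤ) →
  det (suc n) M ≡ laplaceTerm M j
det-firstRowSingle n M j row≡0 = sumFin-single (suc n) _ j λ k k≢j → laplaceTerm-entry≡0 M k (row≡0 k k≢j)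

∣laplaceTerm∣ : ∀ {n} (M : Matrix (suc n) (suc n)) j →
  ∣ laplaceTerm M j ∣ ≡ ∣ M Fin.zero j ∣ ℕ.* ∣ det n (minor M j) ∣
∣laplaceTerm∣ {n} M j = begin
  ∣ sign (toℕ j) * (M Fin.zero j * det n (minor M j)) ∣ ≡⟨ ℤP.abs-* (sign (toℕ j)) _ ⟩
  ∣ sign (toℕ j) ∣ ℕ.* ∣ M Fin.zero j * det n (minor M j) ∣
    ≡⟨ cong₂ ℕ._*_ (∣sign∣ (toℕ j)) (ℤP.abs-* (M Fin.zero j) _) ⟩
  1 ℕ.* (∣ M Fin.zero j ∣ ℕ.* ∣ det n (minor M j) ∣) ≡⟨ ℕP.*-identityˡ _ ⟩
  ∣ M Fin.zero j ∣ ℕ.* ∣ det n (minor M j) ∣ ∎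
  where
  ∣sign∣ : ∀ k → ∣ sign k ∣ ≡ 1
  ∣sign∣ zero    = refl
  ∣sign∣ (suc k) = trans (ℤP.∣-i∣≡∣i∣ (sign k)) (∣sign∣ k)

det-identity : ∀ n (M : Matrix n n) → (∀ i j → M i j ≡ δ j i) → det n M ≡ 1ℤ
det-identity zero    M M≡I = refl
det-identity (suc n) M M≡I = begin
  det (suc n) M                               ≡⟨ det-firstRowSingle n M Fin.zero offDiagonal ⟩
  1ℤ * (M Fin.zero Fin.zero * det n (minor M Fin.zero))
    ≡⟨ cong₂ (λ m d → 1ℤ * (m * d)) (M≡I Fin.zero Fin.zero) (det-identity n _ λ a b → M≡I (Fin.suc a) (Fin.suc b)) ⟩
  1ℤ                                          ∎
  where
  offDiagonal : ∀ k → k ≢ Fin.zero → M Fin.zero k ≡ 0ℤ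
  offDiagonal Fin.zero    0≢0 = ⊥-elim (0≢0 refl)
  offDiagonal (Fin.suc k) _   = M≡I Fin.zero (Fin.suc k)

minor-agreeOff : ∀ {n} {M P : Matrix (suc n) (suc n)} {j c} (j≢c : j ≢ c) →
  (∀ i k → k ≢ c → P i k ≡ M i k) → ∀ i b → b ≢ punchOut j≢c → minor P j i b ≡ minor M j i b
minor-agreeOff {j = j} j≢c P≈M i b b≢c′ = P≈M _ _ λ e →
  b≢c′ (FinP.punchIn-injective j b _ (trans e (sym (FinP.punchIn-punchOut j≢c))))

det-linear-column : ∀ n (c : Fin n) {M N P : Matrix n n} (a : ℤ) →
  (∀ i j → j ≢ c → P i j ≡ M i j) → (∀ i j → j ≢ c → N i j ≡ M i j) →
  (∀ i → P i c ≡ M i c + a * N i c) → det n P ≡ det n M + a * det n N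
det-linear-column (suc n) c {M} {N} {P} a P≈M N≈M Pc≡ =
  trans (sumFin-cong (suc n) term) (sumFin-linear (suc n) (laplaceTerm M) (laplaceTerm N) a)
  where
  distribˡ : ∀ a s m e d → s * ((m + a * e) * d) ≡ s * (m * d) + a * (s * (e * d))
  distribˡ = solve-∀
  distribʳ : ∀ a s m d e → s * (m * (d + a * e)) ≡ s * (m * d) + a * (s * (m * e))
  distribʳ = solve-∀
  term : ∀ j → laplaceTerm P j ≡ laplaceTerm M j + a * laplaceTerm N j
  term j with j Fin.≟ c
  ... | yes refl = begin
    s * (P Fin.zero j * det n (minor P j))
      ≡⟨ cong₂ (λ p d → s * (p * d)) (Pc≡ Fin.zero) (det-cong n λ i b → P≈M (Fin.suc i) _ (FinP.punchInᵢ≢i j b)) ⟩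
    s * ((M Fin.zero j + a * N Fin.zero j) * det n (minor M j))
      ≡⟨ distribˡ a s (M Fin.zero j) (N Fin.zero j) (det n (minor M j)) ⟩
    s * (M Fin.zero j * det n (minor M j)) + a * (s * (N Fin.zero j * det n (minor M j)))
      ≡⟨ cong (λ d → laplaceTerm M j + a * (s * (N Fin.zero j * d)))
              (det-cong n λ i b → sym (N≈M (Fin.suc i) _ (FinP.punchInᵢ≢i j b))) ⟩
    laplaceTerm M j + a * laplaceTerm N j ∎
    where s = sign (toℕ j)
  ... | no j≢c = begin
    s * (P Fin.zero j * det n (minor P j))
      ≡⟨ cong₂ (λ p d → s * (p * d)) (P≈M Fin.zero j j≢c) minor-linear ⟩
    s * (M Fin.zero j * (det n (minor M j) + a * det n (minor N j)))
      ≡⟨ distribʳ a s (M Fin.zero j) (det n (minor M j)) (det n (minor N j)) ⟩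
    s * (M Fin.zero j * det n (minor M j)) + a * (s * (M Fin.zero j * det n (minor N j)))
      ≡⟨ cong (λ m → laplaceTerm M j + a * (s * (m * det n (minor N j)))) (sym (N≈M Fin.zero j j≢c)) ⟩
    laplaceTerm M j + a * laplaceTerm N j ∎
    where
    s = sign (toℕ j)
    minor-linear : det n (minor P j) ≡ det n (minor M j) + a * det n (minor N j)
    minor-linear = det-linear-column n (punchOut j≢c) a (minor-agreeOff j≢c P≈M) (minor-agreeOff j≢c N≈M)
      λ i → subst (λ k → P (Fin.suc i) k ≡ M (Fin.suc i) k + a * N (Fin.suc i) k)
                  (sym (FinP.punchIn-punchOut j≢c)) (Pc≡ (Fin.suc i))

Adjacent : ∀ {n} → Fin n → Fin n → Set
Adjacent x y = toℕ y ≡ suc (toℕ x)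

adjacent⇒≢ : ∀ {n} {x y : Fin n} → Adjacent x y → x ≢ y
adjacent⇒≢ y≡1+x refl = ℕP.1+n≢n (sym y≡1+x)

toℕ-punchIn-< : ∀ {n} (j : Fin (suc n)) b → toℕ b ℕ.< toℕ j → toℕ (punchIn j b) ≡ toℕ b
toℕ-punchIn-< (Fin.suc j) Fin.zero    _         = refl
toℕ-punchIn-< (Fin.suc j) (Fin.suc b) (s≤s b<j) = cong suc (toℕ-punchIn-< j b b<j)

toℕ-punchIn-≥ : ∀ {n} (j : Fin (suc n)) b → toℕ j ≤ toℕ b → toℕ (punchIn j b) ≡ suc (toℕ b)
toℕ-punchIn-≥ Fin.zero    b           _         = refl
toℕ-punchIn-≥ (Fin.suc j) (Fin.suc b) (s≤s j≤b) = cong suc (toℕ-punchIn-≥ j b j≤b)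

punchIn-reflects-adjacent : ∀ {n} (j : Fin (suc n)) x y → Adjacent (punchIn j x) (punchIn j y) → Adjacent x y
punchIn-reflects-adjacent j x y adj with toℕ x ℕ.<? toℕ j | toℕ y ℕ.<? toℕ j
... | yes x<j | yes y<j = trans (sym (toℕ-punchIn-< j y y<j)) (trans adj (cong suc (toℕ-punchIn-< j x x<j)))
... | no x≮j  | no y≮j  = ℕP.suc-injective
  (trans (sym (toℕ-punchIn-≥ j y (ℕP.≮⇒≥ y≮j))) (trans adj (cong suc (toℕ-punchIn-≥ j x (ℕP.≮⇒≥ x≮j)))))
... | yes x<j | no y≮j  = ⊥-elim (ℕP.<-irrefl (sym (ℕP.suc-injective y≡x)) (ℕP.<-≤-trans x<j (ℕP.≮⇒≥ y≮j)))
  where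
  y≡x : suc (toℕ y) ≡ suc (toℕ x)
  y≡x = trans (sym (toℕ-punchIn-≥ j y (ℕP.≮⇒≥ y≮j))) (trans adj (cong suc (toℕ-punchIn-< j x x<j)))
... | no x≮j  | yes y<j = ⊥-elim (ℕP.<-asym y<j (ℕP.≤-<-trans (ℕP.≮⇒≥ x≮j) x<y))
  where
  x<y : toℕ x ℕ.< toℕ y
  x<y = subst (toℕ x ℕ.<_)
    (sym (trans (sym (toℕ-punchIn-< j y y<j)) (trans adj (cong suc (toℕ-punchIn-≥ j x (ℕP.≮⇒≥ x≮j))))))
    (ℕP.m<n⇒m<1+n (ℕP.n<1+n (toℕ x)))

minor-adjacentEqualColumns : ∀ {n} (M : Matrix (suc n) (suc n)) {x y} → Adjacent x y →
  (∀ i → M i x ≡ M i y) → ∀ a b → minor M x a b ≡ minor M y a b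
minor-adjacentEqualColumns M {x} {y} y≡1+x Mx≡My a b with ℕP.<-cmp (toℕ b) (toℕ x)
... | tri< b<x _ _ = cong (M (Fin.suc a)) (FinP.toℕ-injective
  (trans (toℕ-punchIn-< x b b<x) (sym (toℕ-punchIn-< y b b<y))))
  where
  b<y : toℕ b ℕ.< toℕ y
  b<y = ℕP.<-trans b<x (subst (toℕ x ℕ.<_) (sym y≡1+x) (ℕP.n<1+n (toℕ x)))
... | tri≈ _ b≡x _ = begin
  M (Fin.suc a) (punchIn x b) ≡⟨ cong (M (Fin.suc a)) (FinP.toℕ-injective x[b]≡y) ⟩
  M (Fin.suc a) y             ≡⟨ sym (Mx≡My (Fin.suc a)) ⟩
  M (Fin.suc a) x             ≡⟨ cong (M (Fin.suc a)) (FinP.toℕ-injective (sym y[b]≡x)) ⟩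
  M (Fin.suc a) (punchIn y b) ∎
  where
  x[b]≡y : toℕ (punchIn x b) ≡ toℕ y
  x[b]≡y = trans (toℕ-punchIn-≥ x b (ℕP.≤-reflexive (sym b≡x))) (trans (cong suc b≡x) (sym y≡1+x))
  y[b]≡x : toℕ (punchIn y b) ≡ toℕ x
  y[b]≡x = trans (toℕ-punchIn-< y b (subst (toℕ b ℕ.<_) (sym y≡1+x) (s≤s (ℕP.≤-reflexive b≡x)))) b≡x
... | tri> _ _ x<b = cong (M (Fin.suc a)) (FinP.toℕ-injective
  (trans (toℕ-punchIn-≥ x b (ℕP.<⇒≤ x<b)) (sym (toℕ-punchIn-≥ y b (subst (ℕ._≤ toℕ b) (sym y≡1+x) x<b)))))

det-adjacentEqualColumns : ∀ n (M : Matrix n n) {x y} → Adjacent x y → (∀ i → M i x ≡ M i y) → det n M ≡ 0ℤ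
det-adjacentEqualColumns (suc n) M {x} {y} y≡1+x Mx≡My = begin
  det (suc n) M                      ≡⟨ sumFin-pair (suc n) (laplaceTerm M) x y (adjacent⇒≢ y≡1+x) otherTerm≡0 ⟩
  laplaceTerm M x + laplaceTerm M y  ≡⟨ cong₂ (λ m d → laplaceTerm M x + sign (toℕ y) * (m * d))
                                              (sym (Mx≡My Fin.zero))
                                              (sym (det-cong n (minor-adjacentEqualColumns M y≡1+x Mx≡My))) ⟩
  s * (m * d) + sign (toℕ y) * (m * d) ≡⟨ cong (λ t → s * (m * d) + sign t * (m * d)) y≡1+x ⟩
  s * (m * d) + (- s) * (m * d)      ≡⟨ cancel s (m * d) ⟩
  0ℤ                                 ∎
  where
  s = sign (toℕ x)
  m = M Fin.zero x
  d = det n (minor M x)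
  cancel : ∀ s e → s * e + (- s) * e ≡ 0ℤ
  cancel = solve-∀
  otherTerm≡0 : ∀ j → j ≢ x → j ≢ y → laplaceTerm M j ≡ 0ℤ
  otherTerm≡0 j j≢x j≢y = laplaceTerm-minor≡0 M j
    (det-adjacentEqualColumns n (minor M j) adj
      λ i → subst₂ (λ u v → M (Fin.suc i) u ≡ M (Fin.suc i) v)
                   (sym (FinP.punchIn-punchOut j≢x)) (sym (FinP.punchIn-punchOut j≢y)) (Mx≡My (Fin.suc i)))
    where
    adj : Adjacent (punchOut j≢x) (punchOut j≢y)
    adj = punchIn-reflects-adjacent j _ _
      (subst₂ Adjacent (sym (FinP.punchIn-punchOut j≢x)) (sym (FinP.punchIn-punchOut j≢y)) y≡1+x)

column : ∀ {m n} → Matrix m n → Fin n → Col m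
column M j i = M i j

setCol : ∀ {m n} → Matrix m n → Fin n → Col m → Matrix m n
setCol M c u i j = if does (j Fin.≟ c) then u i else M i j

setCol-same : ∀ {m n} (M : Matrix m n) c u i → setCol M c u i c ≡ u i
setCol-same M c u i rewrite dec-true (c Fin.≟ c) refl = refl

setCol-other : ∀ {m n} (M : Matrix m n) {c} u i j → j ≢ c → setCol M c u i j ≡ M i j
setCol-other M {c} u i j j≢c rewrite dec-false (j Fin.≟ c) j≢c = refl

setCol-agreeOff : ∀ {m n} {M N : Matrix m n} {c} → (∀ i j → j ≢ c → M i j ≡ N i j) →
  ∀ d u i j → j ≢ c → setCol M d u i j ≡ setCol N d u i j
setCol-agreeOff M≈N d u i j j≢c with does (j Fin.≟ d)
... | true  = refl
... | false = M≈N i j j≢c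

swapColumns : ∀ {m n} → Matrix m n → Fin n → Fin n → Matrix m n
swapColumns M x y = setCol (setCol M y (column M x)) x (column M y)

_⊕_ : ∀ {m} → Col m → Col m → Col m
(u ⊕ v) i = u i + v i

⊕-as-linear : ∀ {m} (u v : Col m) i → (u ⊕ v) i ≡ u i + 1ℤ * v i
⊕-as-linear u v i = cong (u i +_) (sym (ℤP.*-identityˡ (v i)))

det-setCol-additive : ∀ n (M : Matrix n n) c u v → det n (setCol M c (u ⊕ v)) ≡ det n (setCol M c u) + det n (setCol M c v)
det-setCol-additive n M c u v = begin
  det n (setCol M c (u ⊕ v))                       ≡⟨ det-linear-column n c 1ℤ (offColumn (u ⊕ v)) (offColumn v) onColumn ⟩
  det n (setCol M c u) + 1ℤ * det n (setCol M c v) ≡⟨ cong (det n (setCol M c u) +_) (ℤP.*-identityˡ _) ⟩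
  det n (setCol M c u) + det n (setCol M c v)      ∎
  where
  offColumn : ∀ w i j → j ≢ c → setCol M c w i j ≡ setCol M c u i j
  offColumn w i j j≢c = trans (setCol-other M w i j j≢c) (sym (setCol-other M u i j j≢c))
  onColumn : ∀ i → setCol M c (u ⊕ v) i c ≡ setCol M c u i c + 1ℤ * setCol M c v i c
  onColumn i = trans (setCol-same M c (u ⊕ v) i) (trans (⊕-as-linear u v i)
    (sym (cong₂ (λ a b → a + 1ℤ * b) (setCol-same M c u i) (setCol-same M c v i))))

module TwoColumnsReplaced {n} (M : Matrix n n) {x y : Fin n} (x≢y : x ≢ y) where

  S : Col n → Col n → Matrix n n
  S p q = setCol (setCol M y q) x p

  S-x : ∀ p q i → S p q i x ≡ p i
  S-x p q i = setCol-same (setCol M y q) x p i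

  S-y : ∀ p q i → S p q i y ≡ q i
  S-y p q i = trans (setCol-other (setCol M y q) p i y (x≢y ∘ sym)) (setCol-same M y q i)

  S-original : ∀ i j → S (column M x) (column M y) i j ≡ M i j
  S-original i j = byCases (j Fin.≟ x) (j Fin.≟ y)
    where
    byCases : Dec (j ≡ x) → Dec (j ≡ y) → S (column M x) (column M y) i j ≡ M i j
    byCases (yes refl) _          = S-x (column M x) (column M y) i
    byCases (no j≢x)   (yes refl) = S-y (column M x) (column M y) i
    byCases (no j≢x)   (no j≢y)   =
      trans (setCol-other (setCol M y (column M y)) (column M x) i j j≢x) (setCol-other M (column M y) i j j≢y)

  det-S-additiveˡ : ∀ p p′ q → det n (S (p ⊕ p′) q) ≡ det n (S p q) + det n (S p′ q)
  det-S-additiveˡ p p′ q = det-setCol-additive n (setCol M y q) x p p′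

  det-S-additiveʳ : ∀ p q q′ → det n (S p (q ⊕ q′)) ≡ det n (S p q) + det n (S p q′)
  det-S-additiveʳ p q q′ = begin
    det n (S p (q ⊕ q′))                 ≡⟨ det-linear-column n y 1ℤ offColumn offColumn onColumn ⟩
    det n (S p q) + 1ℤ * det n (S p q′)  ≡⟨ cong (det n (S p q) +_) (ℤP.*-identityˡ _) ⟩
    det n (S p q) + det n (S p q′)       ∎
    where
    offColumn : ∀ {r} i j → j ≢ y → S p r i j ≡ S p q i j
    offColumn {r} = setCol-agreeOff (λ i j j≢y → trans (setCol-other M r i j j≢y) (sym (setCol-other M q i j j≢y))) x p
    onColumn : ∀ i → S p (q ⊕ q′) i y ≡ S p q i y + 1ℤ * S p q′ i y
    onColumn i = trans (S-y p (q ⊕ q′) i) (trans (⊕-as-linear q q′ i)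
      (sym (cong₂ (λ a b → a + 1ℤ * b) (S-y p q i) (S-y p q′ i))))

-- Expanding the vanishing det S (u ⊕ v) (u ⊕ v) bilinearly leaves det M + det (swapColumns M x y).
det-swapAdjacentColumns : ∀ n (M : Matrix n n) {x y} → Adjacent x y → det n (swapColumns M x y) ≡ - det n M
det-swapAdjacentColumns n M {x} {y} y≡1+x = begin
  det n (S v u)                                           ≡⟨ isolate (det n M) (det n (S v u)) ⟩
  ((0ℤ + det n M) + (det n (S v u) + 0ℤ)) + - det n M     ≡⟨ cong (_+ - det n M) expansion≡0 ⟩
  0ℤ + - det n M                                          ≡⟨ ℤP.+-identityˡ (- det n M) ⟩
  - det n M                                               ∎
  where
  open TwoColumnsReplaced M (adjacent⇒≢ y≡1+x)
  u = column M x
  v = column M y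
  isolate : ∀ a b → b ≡ ((0ℤ + a) + (b + 0ℤ)) + - a
  isolate = solve-∀
  S-diagonal≡0 : ∀ w → det n (S w w) ≡ 0ℤ
  S-diagonal≡0 w = det-adjacentEqualColumns n (S w w) y≡1+x λ i → trans (S-x w w i) (sym (S-y w w i))
  expansion≡0 : (0ℤ + det n M) + (det n (S v u) + 0ℤ) ≡ 0ℤ
  expansion≡0 = begin
    (0ℤ + det n M) + (det n (S v u) + 0ℤ)
      ≡⟨ replaceSummands (sym (S-diagonal≡0 u)) (sym (det-cong n S-original)) (sym (S-diagonal≡0 v)) ⟩
    (det n (S u u) + det n (S u v)) + (det n (S v u) + det n (S v v))
      ≡⟨ sym (cong₂ _+_ (det-S-additiveʳ u u v) (det-S-additiveʳ v u v)) ⟩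
    det n (S u (u ⊕ v)) + det n (S v (u ⊕ v))
      ≡⟨ sym (det-S-additiveˡ u v (u ⊕ v)) ⟩
    det n (S (u ⊕ v) (u ⊕ v))
      ≡⟨ S-diagonal≡0 (u ⊕ v) ⟩
    0ℤ ∎
    where
    replaceSummands : ∀ {a a′ b b′ c c′} → a ≡ a′ → b ≡ b′ → c ≡ c′ →
      (a + b) + (det n (S v u) + c) ≡ (a′ + b′) + (det n (S v u) + c′)
    replaceSummands refl refl refl = refl

-- Swapping y with its left neighbour y′ moves the repeated column one step closer to x.
det-equalColumnsAtDistance : ∀ d n (M : Matrix n n) x y → toℕ y ≡ suc (d ℕ.+ toℕ x) →
  (∀ i → M i x ≡ M i y) → det n M ≡ 0ℤ
det-equalColumnsAtDistance zero    n M x y y≡1+x Mx≡My = det-adjacentEqualColumns n M y≡1+x Mx≡My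
det-equalColumnsAtDistance (suc d) n M x y y≡2+d+x Mx≡My = begin
  det n M       ≡⟨ sym (ℤP.neg-involutive (det n M)) ⟩
  - - det n M   ≡⟨ cong -_ (sym (det-swapAdjacentColumns n M y′-y)) ⟩
  - det n M′    ≡⟨ cong -_ (det-equalColumnsAtDistance d n M′ x y′ y′≡1+d+x M′x≡M′y′) ⟩
  0ℤ            ∎
  where
  1+d+x<n : suc (d ℕ.+ toℕ x) ℕ.< n
  1+d+x<n = ℕP.<-trans (subst (suc (d ℕ.+ toℕ x) ℕ.<_) (sym y≡2+d+x) (ℕP.n<1+n _)) (FinP.toℕ<n y)
  y′ = Fin.fromℕ< 1+d+x<n
  y′≡1+d+x : toℕ y′ ≡ suc (d ℕ.+ toℕ x)
  y′≡1+d+x = FinP.toℕ-fromℕ< 1+d+x<n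
  y′-y : Adjacent y′ y
  y′-y = trans y≡2+d+x (cong suc (sym y′≡1+d+x))
  M′ = swapColumns M y′ y
  x≢y′ : x ≢ y′
  x≢y′ x≡y′ = ℕP.<-irrefl (trans (cong toℕ x≡y′) y′≡1+d+x) (s≤s (ℕP.m≤n+m (toℕ x) d))
  x≢y : x ≢ y
  x≢y x≡y = ℕP.<-irrefl (trans (cong toℕ x≡y) y≡2+d+x) (s≤s (ℕP.m≤n+m (toℕ x) (suc d)))
  M′x≡M′y′ : ∀ i → M′ i x ≡ M′ i y′
  M′x≡M′y′ i = begin
    M′ i x  ≡⟨ setCol-other (setCol M y (column M y′)) (column M y) i x x≢y′ ⟩
    setCol M y (column M y′) i x ≡⟨ setCol-other M (column M y′) i x x≢y ⟩
    M i x   ≡⟨ Mx≡My i ⟩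
    M i y   ≡⟨ sym (setCol-same (setCol M y (column M y′)) y′ (column M y) i) ⟩
    M′ i y′ ∎

det-equalColumns-< : ∀ n (M : Matrix n n) {x y} → toℕ x ℕ.< toℕ y → (∀ i → M i x ≡ M i y) → det n M ≡ 0ℤ
det-equalColumns-< n M {x} {y} x<y = det-equalColumnsAtDistance _ n M x y
  (trans (sym (ℕP.m+[n∸m]≡n x<y)) (cong suc (ℕP.+-comm (toℕ x) _)))

det-equalColumns : ∀ n (M : Matrix n n) {x y} → x ≢ y → (∀ i → M i x ≡ M i y) → det n M ≡ 0ℤ
det-equalColumns n M {x} {y} x≢y Mx≡My with ℕP.<-cmp (toℕ x) (toℕ y)
... | tri< x<y _ _ = det-equalColumns-< n M x<y Mx≡My
... | tri≈ _ x≡y _ = ⊥-elim (x≢y (FinP.toℕ-injective x≡y))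
... | tri> _ _ y<x = det-equalColumns-< n M y<x (sym ∘ Mx≡My)

det-addColumnMultiple : ∀ n {M P : Matrix n n} {c d} a → c ≢ d →
  (∀ i j → j ≢ c → P i j ≡ M i j) → (∀ i → P i c ≡ M i c + a * M i d) → det n P ≡ det n M
det-addColumnMultiple n {M} {P} {c} {d} a c≢d P≈M Pc≡ = begin
  det n P                  ≡⟨ det-linear-column n c a P≈M (setCol-other M (column M d)) Pc≡′ ⟩
  det n M + a * det n N    ≡⟨ cong (λ z → det n M + a * z) N≡0 ⟩
  det n M + a * 0ℤ         ≡⟨ cong (det n M +_) (ℤP.*-zeroʳ a) ⟩
  det n M + 0ℤ             ≡⟨ ℤP.+-identityʳ (det n M) ⟩
  det n M                  ∎
  where
  N = setCol M c (column M d)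
  Pc≡′ : ∀ i → P i c ≡ M i c + a * N i c
  Pc≡′ i = trans (Pc≡ i) (cong (λ z → M i c + a * z) (sym (setCol-same M c (column M d) i)))
  N≡0 : det n N ≡ 0ℤ
  N≡0 = det-equalColumns n N c≢d λ i →
    trans (setCol-same M c (column M d) i) (sym (setCol-other M (column M d) i d (c≢d ∘ sym)))

zeroAt : ∀ {n} → Fin n → (Fin n → ℤ) → Fin n → ℤ
zeroAt c b k = if does (k Fin.≟ c) then 0ℤ else b k

zeroAt-same : ∀ {n} c (b : Fin n → ℤ) → zeroAt c b c ≡ 0ℤ
zeroAt-same c b rewrite dec-true (c Fin.≟ c) refl = refl

zeroAt-other : ∀ {n} {c} (b : Fin n → ℤ) k → k ≢ c → zeroAt c b k ≡ b k
zeroAt-other {c = c} b k k≢c rewrite dec-false (k Fin.≟ c) k≢c = refl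

zeroAt-pointwise : ∀ {n} {c} (b : Fin n → ℤ) k → (k ≡ c → b k ≡ 0ℤ) → zeroAt c b k ≡ b k
zeroAt-pointwise {c = c} b k bc≡0 with k Fin.≟ c
... | yes k≡c = sym (bc≡0 k≡c)
... | no  _   = refl

zeroAt-vanishes : ∀ {n} {c} (b : Fin n → ℤ) k → (k ≢ c → b k ≡ 0ℤ) → zeroAt c b k ≡ 0ℤ
zeroAt-vanishes {c = c} b k bk≡0 with k Fin.≟ c
... | yes _   = refl
... | no  k≢c = bk≡0 k≢c

addMultiples : ∀ {m n} → Matrix m n → Fin n → (Fin n → ℤ) → Matrix m n
addMultiples M j b i k = M i k + b k * M i j

addMultiples-unchanged : ∀ {m n} (M : Matrix m n) j b k → b k ≡ 0ℤ → ∀ i → addMultiples M j b i k ≡ M i k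
addMultiples-unchanged M j b k bk≡0 i = begin
  M i k + b k * M i j ≡⟨ cong (λ e → M i k + e * M i j) bk≡0 ⟩
  M i k + 0ℤ * M i j  ≡⟨ cong (M i k +_) (ℤP.*-zeroˡ (M i j)) ⟩
  M i k + 0ℤ          ≡⟨ ℤP.+-identityʳ (M i k) ⟩
  M i k               ∎

addMultiples-zeroAt : ∀ {m n} (M : Matrix m n) j a i k → k ≢ j → addMultiples M j (zeroAt j a) i k ≡ M i k + a k * M i j
addMultiples-zeroAt M j a i k k≢j = cong (λ e → M i k + e * M i j) (zeroAt-other a k k≢j)

det-addMultiples-dropOne : ∀ n (M : Matrix n n) j b → b j ≡ 0ℤ → ∀ c →
  det n (addMultiples M j b) ≡ det n (addMultiples M j (zeroAt c b))
det-addMultiples-dropOne n M j b bj≡0 c with c Fin.≟ j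
... | yes c≡j = det-cong n λ i k → cong (λ e → M i k + e * M i j)
  (sym (zeroAt-pointwise b k λ k≡c → trans (cong b (trans k≡c c≡j)) bj≡0))
... | no  c≢j = det-addColumnMultiple n (b c) c≢j
  (λ i k k≢c → cong (λ e → M i k + e * M i j) (sym (zeroAt-other b k k≢c)))
  λ i → sym (cong₂ (λ x y → x + b c * y) (addMultiples-unchanged M j (zeroAt c b) c (zeroAt-same c b) i)
                                         (addMultiples-unchanged M j (zeroAt c b) j (zeroAt-vanishes b j λ _ → bj≡0) i))

det-addMultiples : ∀ n (M : Matrix n n) j b → b j ≡ 0ℤ → det n (addMultiples M j b) ≡ det n M
det-addMultiples n M j b bj≡0 = supportedBelow n b bj≡0 λ k n≤k → ⊥-elim (ℕP.<⇒≱ (FinP.toℕ<n k) n≤k)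
  where
  supportedBelow : ∀ t b → b j ≡ 0ℤ → (∀ k → t ≤ toℕ k → b k ≡ 0ℤ) → det n (addMultiples M j b) ≡ det n M
  supportedBelow zero    b _     b≡0 = det-cong n λ i k → addMultiples-unchanged M j b k (b≡0 k z≤n) i
  supportedBelow (suc t) b bj≡0 b≡0 with t ℕ.<? n
  ... | no t≮n  = supportedBelow t b bj≡0 λ k t≤k → ⊥-elim (t≮n (ℕP.≤-<-trans t≤k (FinP.toℕ<n k)))
  ... | yes t<n = trans (det-addMultiples-dropOne n M j b bj≡0 c)
    (supportedBelow t (zeroAt c b) (zeroAt-vanishes b j λ _ → bj≡0) λ k t≤k → zeroAt-vanishes b k λ k≢c →
      b≡0 k (ℕP.≤∧≢⇒< t≤k λ t≡k → k≢c (FinP.toℕ-injective (trans (sym t≡k) (sym (FinP.toℕ-fromℕ< t<n))))))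
    where
    c = Fin.fromℕ< t<n

-- Network matrices

-- unitCol (just p) is the p-th unit vector (the zero vector when p ≥ n), unitCol nothing is zero.
unitCol : ∀ {n} → Maybe ℕ → Col n
unitCol (just p) k = if toℕ k ℕ.≡ᵇ p then 1ℤ else 0ℤ
unitCol nothing  k = 0ℤ

Network : ∀ {n} → Col n → Set
Network v = Σ (Maybe ℕ) λ p → Σ (Maybe ℕ) λ q → ∀ k → v k ≡ unitCol p k + - unitCol q k

Network-cong : ∀ {n} {v w : Col n} → (∀ k → v k ≡ w k) → Network w → Network v
Network-cong v≡w (p , q , w≡) = p , q , λ k → trans (v≡w k) (w≡ k)

shiftDown : Maybe ℕ → Maybe ℕ
shiftDown nothing        = nothing
shiftDown (just zero)    = nothing
shiftDown (just (suc p)) = just p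

unitCol-suc : ∀ {n} p (k : Fin n) → unitCol p (Fin.suc k) ≡ unitCol (shiftDown p) k
unitCol-suc nothing        k = refl
unitCol-suc (just zero)    k = refl
unitCol-suc (just (suc p)) k = refl

tail-unitDifference : ∀ {n} {v : Col (suc n)} p q → (∀ k → v k ≡ unitCol p k + - unitCol q k) →
  ∀ k → v (Fin.suc k) ≡ unitCol (shiftDown p) k + - unitCol (shiftDown q) k
tail-unitDifference p q v≡ k = trans (v≡ (Fin.suc k)) (cong₂ (λ a b → a + - b) (unitCol-suc p k) (unitCol-suc q k))

data AtHead : Maybe ℕ → Set where
  here      : AtHead (just 0)
  elsewhere : ∀ {p} → (∀ {n} → unitCol {suc n} p Fin.zero ≡ 0ℤ) → AtHead p

atHead : ∀ p → AtHead p
atHead nothing        = elsewhere refl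
atHead (just zero)    = here
atHead (just (suc p)) = elsewhere refl

data HeadView {n} (v : Col (suc n)) : Set where
  head-zero  : v Fin.zero ≡ 0ℤ → Network (v ∘ Fin.suc) → HeadView v
  head-plus  : ∀ q → v Fin.zero ≡ 1ℤ → (∀ k → v (Fin.suc k) ≡ - unitCol q k) → HeadView v
  head-minus : ∀ p → v Fin.zero ≡ - 1ℤ → (∀ k → v (Fin.suc k) ≡ unitCol p k) → HeadView v

headView : ∀ {n} {v : Col (suc n)} → Network v → HeadView v
headView {v = v} (p , q , v≡) with atHead p | atHead q
... | here         | here         = head-zero (v≡ Fin.zero) (shiftDown p , shiftDown q , tail-unitDifference p q v≡)
... | here         | elsewhere q₀ = head-plus (shiftDown q) (trans (v≡ Fin.zero) (cong (λ b → 1ℤ + - b) q₀))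
  λ k → trans (tail-unitDifference p q v≡ k) (ℤP.+-identityˡ _)
... | elsewhere p₀ | here         = head-minus (shiftDown p) (trans (v≡ Fin.zero) (cong (_+ - 1ℤ) p₀))
  λ k → trans (tail-unitDifference p q v≡ k) (ℤP.+-identityʳ _)
... | elsewhere p₀ | elsewhere q₀ = head-zero (trans (v≡ Fin.zero) (cong₂ (λ a b → a + - b) p₀ q₀))
  (shiftDown p , shiftDown q , tail-unitDifference p q v≡)

network-pivot : ∀ {n} {v w : Col (suc n)} → Network v → Network w → w Fin.zero ≢ 0ℤ →
  Network (λ k → v (Fin.suc k) + - (v Fin.zero * w Fin.zero) * w (Fin.suc k))
network-pivot {v = v} {w} nv nw w₀≢0 = combine (headView nv) (headView nw)
  where
  entries : ∀ {σ τ x y} k → v Fin.zero ≡ σ → w Fin.zero ≡ τ → v (Fin.suc k) ≡ x → w (Fin.suc k) ≡ y →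
    v (Fin.suc k) + - (v Fin.zero * w Fin.zero) * w (Fin.suc k) ≡ x + - (σ * τ) * y
  entries k refl refl refl refl = refl
  zero-pivot : ∀ τ x y → x + - (0ℤ * τ) * y ≡ x
  zero-pivot = solve-∀
  plus-plus : ∀ a b → - a + - (1ℤ * 1ℤ) * - b ≡ b + - a
  plus-plus = solve-∀
  plus-minus : ∀ a b → - a + - (1ℤ * - 1ℤ) * b ≡ b + - a
  plus-minus = solve-∀
  minus-plus : ∀ a b → a + - (- 1ℤ * 1ℤ) * - b ≡ a + - b
  minus-plus = solve-∀
  minus-minus : ∀ a b → a + - (- 1ℤ * - 1ℤ) * b ≡ a + - b
  minus-minus = solve-∀
  combine : HeadView v → HeadView w → Network (λ k → v (Fin.suc k) + - (v Fin.zero * w Fin.zero) * w (Fin.suc k))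
  combine _ (head-zero w₀≡0 _) = ⊥-elim (w₀≢0 w₀≡0)
  combine (head-zero v₀≡0 (p , q , v≡)) _ = p , q , λ k →
    trans (entries k v₀≡0 refl refl refl) (trans (zero-pivot (w Fin.zero) _ (w (Fin.suc k))) (v≡ k))
  combine (head-plus q v₀≡ v≡) (head-plus q′ w₀≡ w≡) = q′ , q , λ k →
    trans (entries k v₀≡ w₀≡ (v≡ k) (w≡ k)) (plus-plus (unitCol q k) (unitCol q′ k))
  combine (head-plus q v₀≡ v≡) (head-minus p′ w₀≡ w≡) = p′ , q , λ k →
    trans (entries k v₀≡ w₀≡ (v≡ k) (w≡ k)) (plus-minus (unitCol q k) (unitCol p′ k))
  combine (head-minus p v₀≡ v≡) (head-plus q′ w₀≡ w≡) = p , q′ , λ k →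
    trans (entries k v₀≡ w₀≡ (v≡ k) (w≡ k)) (minus-plus (unitCol p k) (unitCol q′ k))
  combine (head-minus p v₀≡ v≡) (head-minus p′ w₀≡ w≡) = p , p′ , λ k →
    trans (entries k v₀≡ w₀≡ (v≡ k) (w≡ k)) (minus-minus (unitCol p k) (unitCol p′ k))

network-head-unit : ∀ {n} {v : Col (suc n)} → Network v → v Fin.zero ≢ 0ℤ →
  ∣ v Fin.zero ∣ ≡ 1 × v Fin.zero * v Fin.zero ≡ 1ℤ
network-head-unit nv v₀≢0 with headView nv
... | head-zero  v₀≡0 _  = ⊥-elim (v₀≢0 v₀≡0)
... | head-plus  _ v₀≡ _ rewrite v₀≡ = refl , refl
... | head-minus _ v₀≡ _ rewrite v₀≡ = refl , refl

det-network≤1 : ∀ n (M : Matrix n n) → (∀ j → Network (column M j)) → ∣ det n M ∣ ≤ 1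
det-network≤1 zero    M _   = ℕP.≤-refl
det-network≤1 (suc n) M net with all⊎any (suc n) (λ j → toSum (M Fin.zero j ℤ.≟ 0ℤ))
... | inj₁ row≡0     = subst (λ d → ∣ d ∣ ≤ 1) (sym (det-firstRowZero n M row≡0)) z≤n
... | inj₂ (j , e≢0) = subst (_≤ 1) (sym ∣detM∣≡∣d∣) (det-network≤1 n (minor T j) minor-network)
  where
  e = M Fin.zero j
  a : Fin (suc n) → ℤ
  a k = - (M Fin.zero k * e)
  T = addMultiples M j (zeroAt j a)
  T-pivot : ∀ i → T i j ≡ M i j
  T-pivot = addMultiples-unchanged M j (zeroAt j a) j (zeroAt-same j a)
  detT≡detM : det (suc n) T ≡ det (suc n) M
  detT≡detM = det-addMultiples (suc n) M j (zeroAt j a) (zeroAt-same j a)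
  e-unit : ∣ e ∣ ≡ 1 × e * e ≡ 1ℤ
  e-unit = network-head-unit (net j) e≢0
  clear : ∀ x e → x + - (x * e) * e ≡ x * (1ℤ + - (e * e))
  clear = solve-∀
  T-row : ∀ k → k ≢ j → T Fin.zero k ≡ 0ℤ
  T-row k k≢j = begin
    T Fin.zero k                          ≡⟨ addMultiples-zeroAt M j a Fin.zero k k≢j ⟩
    M Fin.zero k + - (M Fin.zero k * e) * e ≡⟨ clear (M Fin.zero k) e ⟩
    M Fin.zero k * (1ℤ + - (e * e))       ≡⟨ cong (λ s → M Fin.zero k * (1ℤ + - s)) (proj₂ e-unit) ⟩
    M Fin.zero k * 0ℤ                     ≡⟨ ℤP.*-zeroʳ (M Fin.zero k) ⟩
    0ℤ                                    ∎
  minor-network : ∀ b → Network (column (minor T j) b)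
  minor-network b = Network-cong (λ x → addMultiples-zeroAt M j a (Fin.suc x) (punchIn j b) (FinP.punchInᵢ≢i j b))
    (network-pivot (net (punchIn j b)) (net j) e≢0)
  ∣detM∣≡∣d∣ : ∣ det (suc n) M ∣ ≡ ∣ det n (minor T j) ∣
  ∣detM∣≡∣d∣ = begin
    ∣ det (suc n) M ∣                          ≡⟨ cong ∣_∣ (sym detT≡detM) ⟩
    ∣ det (suc n) T ∣                          ≡⟨ cong ∣_∣ (det-firstRowSingle n T j T-row) ⟩
    ∣ laplaceTerm T j ∣                        ≡⟨ ∣laplaceTerm∣ T j ⟩
    ∣ T Fin.zero j ∣ ℕ.* ∣ det n (minor T j) ∣ ≡⟨ cong (λ t → ∣ t ∣ ℕ.* ∣ det n (minor T j) ∣) (T-pivot Fin.zero) ⟩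
    ∣ e ∣ ℕ.* ∣ det n (minor T j) ∣            ≡⟨ cong (ℕ._* ∣ det n (minor T j) ∣) (proj₁ e-unit) ⟩
    1 ℕ.* ∣ det n (minor T j) ∣                ≡⟨ ℕP.*-identityˡ _ ⟩
    ∣ det n (minor T j) ∣                      ∎

TwoHeaded : ∀ {n} → Col n → Set
TwoHeaded v = Σ (Maybe ℕ) λ q → ∀ k → v k ≡ (unitCol (just 0) k + unitCol (just 1) k) + - unitCol q k

NetworkOrTwoHeaded : ∀ {n} → Col n → Set
NetworkOrTwoHeaded v = Network v ⊎ TwoHeaded v

setCol-network : ∀ {n} (M : Matrix n n) j {u} → Network u → (∀ k → k ≢ j → Network (column M k)) →
  ∀ k → Network (column (setCol M j u) k)
setCol-network M j {u} net-u net-M k = byCases (k Fin.≟ j)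
  where
  byCases : Dec (k ≡ j) → Network (column (setCol M j u) k)
  byCases (yes refl) = Network-cong (setCol-same M j u) net-u
  byCases (no k≢j)   = Network-cong (λ i → setCol-other M u i k k≢j) (net-M k k≢j)

twoHeaded-difference : ∀ {n} {v w : Col n} → TwoHeaded v → TwoHeaded w → Network (λ i → v i + - 1ℤ * w i)
twoHeaded-difference (q , v≡) (q′ , w≡) = q′ , q , λ i →
  trans (cong₂ (λ x y → x + - 1ℤ * y) (v≡ i) (w≡ i)) (difference (unitCol (just 0) i + unitCol (just 1) i) _ _)
  where
  difference : ∀ s x y → (s + - x) + - 1ℤ * (s + - y) ≡ y + - x
  difference = solve-∀

det-oneTwoHeaded≤2 : ∀ n (M : Matrix n n) j → TwoHeaded (column M j) → (∀ k → k ≢ j → Network (column M k)) →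
  ∣ det n M ∣ ≤ 2
det-oneTwoHeaded≤2 n M j (q , Mj≡) net = subst (_≤ 2) (cong ∣_∣ detN₁+detN₂≡detM) (ℕP.≤-trans
  (ℤP.∣i+j∣≤∣i∣+∣j∣ (det n N₁) (1ℤ * det n N₂))
  (ℕP.+-mono-≤ (det-network≤1 n N₁ (setCol-network M j (just 0 , q , λ _ → refl) net))
               (subst (_≤ 1) (cong ∣_∣ (sym (ℤP.*-identityˡ (det n N₂))))
                      (det-network≤1 n N₂ (setCol-network M j (just 1 , nothing , λ _ → sym (ℤP.+-identityʳ _)) net)))))
  where
  u₁ u₂ : Col n
  u₁ i = unitCol (just 0) i + - unitCol q i
  u₂ = unitCol (just 1)
  N₁ = setCol M j u₁
  N₂ = setCol M j u₂
  regroup : ∀ x y z → (x + y) + - z ≡ (x + - z) + 1ℤ * y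
  regroup = solve-∀
  Mj-split : ∀ i → M i j ≡ N₁ i j + 1ℤ * N₂ i j
  Mj-split i = begin
    M i j                                                     ≡⟨ Mj≡ i ⟩
    (unitCol (just 0) i + unitCol (just 1) i) + - unitCol q i ≡⟨ regroup (unitCol (just 0) i) _ _ ⟩
    u₁ i + 1ℤ * u₂ i                                          ≡⟨ sym (cong₂ (λ x y → x + 1ℤ * y)
                                                                     (setCol-same M j u₁ i) (setCol-same M j u₂ i)) ⟩
    N₁ i j + 1ℤ * N₂ i j                                      ∎
  detN₁+detN₂≡detM : det n N₁ + 1ℤ * det n N₂ ≡ det n M
  detN₁+detN₂≡detM = sym (det-linear-column n j 1ℤ
    (λ i k k≢j → sym (setCol-other M u₁ i k k≢j))
    (λ i k k≢j → trans (setCol-other M u₂ i k k≢j) (sym (setCol-other M u₁ i k k≢j)))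
    Mj-split)

det-networkOrTwoHeaded≤2 : ∀ n (M : Matrix n n) → (∀ j → NetworkOrTwoHeaded (column M j)) →
  ∣ det n M ∣ ≤ 2
det-networkOrTwoHeaded≤2 n M kind with all⊎any n kind
... | inj₁ net             = ℕP.≤-trans (det-network≤1 n M net) (ℕP.n≤1+n 1)
... | inj₂ (j , q , Mj≡) = subst (_≤ 2) (cong ∣_∣ (det-addMultiples n M j (zeroAt j a) (zeroAt-same j a)))
  (det-oneTwoHeaded≤2 n T j (q , λ i → trans (addMultiples-unchanged M j (zeroAt j a) j (zeroAt-same j a) i) (Mj≡ i))
    λ k k≢j → Network-cong (λ i → addMultiples-zeroAt M j a i k k≢j) (reduced (kind k)))
  where
  coefficient : ∀ {k} → NetworkOrTwoHeaded (column M k) → ℤ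
  coefficient (inj₁ _) = 0ℤ
  coefficient (inj₂ _) = - 1ℤ
  a : Fin n → ℤ
  a k = coefficient (kind k)
  T = addMultiples M j (zeroAt j a)
  unchanged : ∀ x y → x + 0ℤ * y ≡ x
  unchanged = solve-∀
  reduced : ∀ {k} (c : NetworkOrTwoHeaded (column M k)) → Network (λ i → M i k + coefficient c * M i j)
  reduced (inj₁ net)        = Network-cong (λ i → unchanged _ (M i j)) net
  reduced (inj₂ twoHeaded)  = twoHeaded-difference twoHeaded (q , Mj≡)

-- Increasing index maps and rank

increasing-suc : ∀ {k m} {f : Fin (suc k) → Fin m} → Increasing f → Increasing (f ∘ Fin.suc)
increasing-suc f-inc i j i<j = f-inc (Fin.suc i) (Fin.suc j) (s≤s i<j)

increasing-lower : ∀ {k m} {f : Fin (suc k) → Fin m} → Increasing f → ∀ i → toℕ (f Fin.zero) ℕ.+ toℕ i ≤ toℕ (f i)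
increasing-lower f-inc Fin.zero = ℕP.≤-reflexive (ℕP.+-identityʳ _)
increasing-lower {suc k} {f = f} f-inc (Fin.suc i) = ℕP.≤-trans
  (ℕP.≤-reflexive (ℕP.+-suc (toℕ (f Fin.zero)) (toℕ i)))
  (ℕP.≤-trans (ℕP.+-monoˡ-≤ (toℕ i) (f-inc Fin.zero (Fin.suc Fin.zero) (s≤s z≤n)))
              (increasing-lower (increasing-suc f-inc) i))

increasing-upper : ∀ {k m} {f : Fin (suc k) → Fin m} → Increasing f → ∀ i → toℕ (f i) ℕ.+ (k ℕ.∸ toℕ i) ℕ.< m
increasing-upper {zero} {m} {f} f-inc Fin.zero = subst (ℕ._< m) (sym (ℕP.+-identityʳ _)) (FinP.toℕ<n (f Fin.zero))
increasing-upper {suc k} {m} {f} f-inc Fin.zero = ℕP.≤-<-trans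
  (ℕP.≤-trans (ℕP.≤-reflexive (ℕP.+-suc (toℕ (f Fin.zero)) k))
              (ℕP.+-monoˡ-≤ k (f-inc Fin.zero (Fin.suc Fin.zero) (s≤s z≤n))))
  (increasing-upper (increasing-suc f-inc) Fin.zero)
increasing-upper {suc k} f-inc (Fin.suc i) = increasing-upper (increasing-suc f-inc) i

increasing-endo≡id : ∀ {n} {f : Fin n → Fin n} → Increasing f → ∀ i → f i ≡ i
increasing-endo≡id {suc n} {f} f-inc i = FinP.toℕ-injective (ℕP.≤-antisym fi≤i i≤fi)
  where
  i≤fi : toℕ i ≤ toℕ (f i)
  i≤fi = ℕP.≤-trans (ℕP.m≤n+m (toℕ i) _) (increasing-lower f-inc i)
  fi≤i : toℕ (f i) ≤ toℕ i
  fi≤i = ℕP.+-cancelʳ-≤ (n ℕ.∸ toℕ i) (toℕ (f i)) (toℕ i)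
    (ℕP.≤-trans (ℕP.≤-pred (increasing-upper f-inc i))
                (ℕP.≤-reflexive (sym (ℕP.m+[n∸m]≡n (ℕP.≤-pred (FinP.toℕ<n i))))))

rank≤rows : ∀ {m n} (A : Matrix m n) k → HasRank A k → k ≤ m
rank≤rows A k ((f , _ , f-inc , _) , _) = ℕP.≮⇒≥ λ m<k →
  let (i , j , i<j , fi≡fj) = FinP.pigeonhole m<k f in ℕP.<-irrefl (cong toℕ fi≡fj) (f-inc i j i<j)

nonzeroMinor⇒≤rank : ∀ {m n} (A : Matrix m n) l (f : Fin l → Fin m) (g : Fin l → Fin n) →
  Increasing f → Increasing g → det l (submatrix A f g) ≢ 0ℤ → ∀ k → HasRank A k → l ≤ k
nonzeroMinor⇒≤rank A l f g f-inc g-inc minor≢0 k (_ , larger≡0) =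
  ℕP.≮⇒≥ λ k<l → minor≢0 (larger≡0 l k<l f g f-inc g-inc)

lookup-map-tabulate-++ : ∀ {A B : Set} {n} (h : Fin n → B) (f : B → A) ys i →
  Σ (Fin (length (map f (tabulate h) ++ ys))) λ i′ → toℕ i′ ≡ toℕ i × lookup (map f (tabulate h) ++ ys) i′ ≡ f (h i)
lookup-map-tabulate-++ h f ys Fin.zero    = Fin.zero , refl , refl
lookup-map-tabulate-++ h f ys (Fin.suc i) with lookup-map-tabulate-++ (h ∘ Fin.suc) f ys i
... | i′ , i′≡i , lookup≡ = Fin.suc i′ , cong suc i′≡i , lookup≡

-- The matrix A'_r

A'-rank : ∀ r k → HasRank (A' r) k → k ≡ r
A'-rank r k rank = ℕP.≤-antisym (rank≤rows (A' r) k rank)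
  (nonzeroMinor⇒≤rank (A' r) r (λ i → i) unitColumn (λ _ _ i<j → i<j) unitColumn-increasing identity≢0 k rank)
  where
  located = lookup-map-tabulate-++ (λ i → i) (λ i → δ i) (Dcols r ++ Bcols r ++ cCol r ∷ [])
  unitColumn : Fin r → Fin (length (A'cols r))
  unitColumn i = proj₁ (located i)
  unitColumn-increasing : Increasing unitColumn
  unitColumn-increasing i j i<j = subst₂ ℕ._<_ (sym (proj₁ (proj₂ (located i)))) (sym (proj₁ (proj₂ (located j)))) i<j
  identity≢0 : det r (submatrix (A' r) (λ i → i) unitColumn) ≢ 0ℤ
  identity≢0 det≡0 with trans (sym (det-identity r _ λ a b → cong (λ c → c a) (proj₂ (proj₂ (located b))))) det≡0
  ... | ()

A'-columns : ∀ r → All NetworkOrTwoHeaded (A'cols r)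
A'-columns r = ++⁺ identityKinds (++⁺ D-kinds (++⁺ B-kinds (inj₂ (nothing , λ k → c-entry (toℕ k)) ∷ [])))
  where
  identityKinds : All NetworkOrTwoHeaded (identityCols r)
  identityKinds = map⁺ {f = δ} (tabulate⁺ {f = λ i → i} λ i →
    inj₁ (just (toℕ i) , nothing , λ k → sym (ℤP.+-identityʳ _)))
  D-column : ∀ i j b → All NetworkOrTwoHeaded (if b then (λ k → δ i k + - δ j k) ∷ [] else [])
  D-column i j true  = inj₁ (just (toℕ i) , just (toℕ j) , λ k → refl) ∷ []
  D-column i j false = []
  D-kinds : All NetworkOrTwoHeaded (Dcols r)
  D-kinds = concat⁺ (map⁺ (tabulate⁺ {f = λ i → i} λ i →
    concat⁺ (map⁺ (tabulate⁺ {f = λ j → j} λ j → D-column i j (toℕ i ℕ.<ᵇ toℕ j)))))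
  B-entry : ∀ t m → (if m ℕ.<ᵇ 2 then 1ℤ else (if m ℕ.≡ᵇ (2 ℕ.+ t) then - 1ℤ else 0ℤ))
    ≡ ((if m ℕ.≡ᵇ 0 then 1ℤ else 0ℤ) + (if m ℕ.≡ᵇ 1 then 1ℤ else 0ℤ))
      + - (if m ℕ.≡ᵇ (2 ℕ.+ t) then 1ℤ else 0ℤ)
  B-entry t zero          = refl
  B-entry t (suc zero)    = refl
  B-entry t (suc (suc m)) with m ℕ.≡ᵇ t
  ... | true  = refl
  ... | false = refl
  c-entry : ∀ m → (if m ℕ.<ᵇ 2 then 1ℤ else 0ℤ)
    ≡ ((if m ℕ.≡ᵇ 0 then 1ℤ else 0ℤ) + (if m ℕ.≡ᵇ 1 then 1ℤ else 0ℤ)) + - 0ℤ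
  c-entry zero          = refl
  c-entry (suc zero)    = refl
  c-entry (suc (suc m)) = refl
  B-kinds : All NetworkOrTwoHeaded (Bcols r)
  B-kinds = map⁺ (applyUpTo⁺₂ (λ t → t) (r ℕ.∸ 2) λ t → inj₂ (just (2 ℕ.+ t) , λ k → B-entry t (toℕ k)))

lemma3p2 : ∀ (r : ℕ) → 2 ≤ r → IsModular 2 (A' r)
lemma3p2 r _ k rank f g f-inc g-inc with A'-rank r k rank
... | refl = subst (λ d → ∣ d ∣ ≤ 2)
  (det-cong r λ i j → cong (lookup (A'cols r) (g j)) (sym (increasing-endo≡id f-inc i)))
  (det-networkOrTwoHeaded≤2 r (λ i j → A' r i (g j)) λ j → All.lookup (A'-columns r) (∈-lookup (g j)))
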